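{- For all behaviours B, B1 and B2: if B [>>] B1 and B [>>] B2, then there exists a behaviour B' such that B1 [V] B2 == B' and B [>>] B'.
   Context: Behaviours of the process language SP are given by the grammar B ::= End | p!e @! a; B | p?x @? a; B | p(+)l @+ a; B | p & mB1 // mB2 | If e Then B1 Else B2 | Call X, with mB ::= None | Some (a,B) and labels l in {left, right}; in the branching term p & mB1 // mB2, mB1 is the (optional, annotated) behaviour offered for label left and mB2 the one for label right. The merge relation B1 [V] B2 == B (merge B1 B2 B) is defined inductively: End [V] End == End; Call X [V] Call X == Call X; two send terms (resp. receive, selection terms) with identical prefix merge to that prefix followed by the merge of their continuations; two conditionals with the same guard merge branchwise; two branching terms on the same process p merge label by label: if both offer a label (with the same annotation) the continuations are merged, if only one offers it that offer is kept, if neither offers it the result offers None. No other pairs are mergeable. The branching order B [>>] B' (more_branches) is defined inductively: End [>>] End; Call X [>>] Call X; congruence for send, receive and selection prefixes and for conditionals; and for branching terms p & mBl // mBr [>>] p & None // None, p & mBl // Some (a,Br) [>>] p & None // Some (a,Br') if Br [>>] Br', p & Some (a,Bl) // mBr [>>] p & Some (a,Bl') // None if Bl [>>] Bl', and p & Some (a,Bl) // Some (a',Br) [>>] p & Some (a,Bl') // Some (a',Br') if Bl [>>] Bl' and Br [>>] Br'. Intuitively, B [>>] B' means B offers at least the branches offered by B'. -}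

module Defs where

open import Data.Maybe using (Maybe; just; nothing)
open import Data.Product using (_×_; _,_)

-- Syntactic categories of SP are kept abstract:
--   P : process names, E : expressions, V : variables,
--   A : annotations, X : procedure (recursion) names.
data Label : Set where
  left right : Label

module SP (P E V A X : Set) where

  data Behaviour : Set where
    End    : Behaviour
    Send   : P → E → A → Behaviour → Behaviour
    Recv   : P → V → A → Behaviour → Behaviour
    Sel    : P → Label → A → Behaviour → Behaviour
    Branch : P → Maybe (A × Behaviour) → Maybe (A × Behaviour) → Behaviour
    Ite    : E → Behaviour → Behaviour → Behaviour
    Call   : X → Behaviour

  data Merge : Behaviour → Behaviour → Behaviour → Set
  data MergeOpt : Maybe (A × Behaviour) → Maybe (A × Behaviour) → Maybe (A × Behaviour) → Set

  data Merge where
    m-end  : Merge End End End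
    m-call : ∀ {x} → Merge (Call x) (Call x) (Call x)
    m-send : ∀ {p e a B1 B2 B} → Merge B1 B2 B →
             Merge (Send p e a B1) (Send p e a B2) (Send p e a B)
    m-recv : ∀ {p x a B1 B2 B} → Merge B1 B2 B →
             Merge (Recv p x a B1) (Recv p x a B2) (Recv p x a B)
    m-sel  : ∀ {p l a B1 B2 B} → Merge B1 B2 B →
             Merge (Sel p l a B1) (Sel p l a B2) (Sel p l a B)
    m-ite  : ∀ {e B1 B2 B1' B2' B B'} → Merge B1 B1' B → Merge B2 B2' B' →
             Merge (Ite e B1 B2) (Ite e B1' B2') (Ite e B B')
    m-branch : ∀ {p ml1 mr1 ml2 mr2 ml mr} →
             MergeOpt ml1 ml2 ml → MergeOpt mr1 mr2 mr →
             Merge (Branch p ml1 mr1) (Branch p ml2 mr2) (Branch p ml mr)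

  data MergeOpt where
    mo-both  : ∀ {a B1 B2 B} → Merge B1 B2 B →
               MergeOpt (just (a , B1)) (just (a , B2)) (just (a , B))
    mo-left  : ∀ {a B} → MergeOpt (just (a , B)) nothing (just (a , B))
    mo-right : ∀ {a B} → MergeOpt nothing (just (a , B)) (just (a , B))
    mo-none  : MergeOpt nothing nothing nothing

  data MoreBranches : Behaviour → Behaviour → Set where
    mb-end  : MoreBranches End End
    mb-call : ∀ {x} → MoreBranches (Call x) (Call x)
    mb-send : ∀ {p e a B B'} → MoreBranches B B' →
              MoreBranches (Send p e a B) (Send p e a B')
    mb-recv : ∀ {p x a B B'} → MoreBranches B B' →
              MoreBranches (Recv p x a B) (Recv p x a B')
    mb-sel  : ∀ {p l a B B'} → MoreBranches B B' →
              MoreBranches (Sel p l a B) (Sel p l a B')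
    mb-ite  : ∀ {e B1 B2 B1' B2'} → MoreBranches B1 B1' → MoreBranches B2 B2' →
              MoreBranches (Ite e B1 B2) (Ite e B1' B2')
    mb-none : ∀ {p mBl mBr} →
              MoreBranches (Branch p mBl mBr) (Branch p nothing nothing)
    mb-right : ∀ {p mBl a Br Br'} → MoreBranches Br Br' →
              MoreBranches (Branch p mBl (just (a , Br))) (Branch p nothing (just (a , Br')))
    mb-left : ∀ {p a Bl Bl' mBr} → MoreBranches Bl Bl' →
              MoreBranches (Branch p (just (a , Bl)) mBr) (Branch p (just (a , Bl')) nothing)
    mb-both : ∀ {p a a' Bl Bl' Br Br'} → MoreBranches Bl Bl' → MoreBranches Br Br' →
              MoreBranches (Branch p (just (a , Bl)) (just (a' , Br)))
                           (Branch p (just (a , Bl')) (just (a' , Br')))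

-- On branching terms B [>>] B' holds label by label: B' either drops a label or keeps
-- it with a [>>]-smaller continuation.  Two such reductions of the same label are
-- therefore both dropped (merge to None), one kept (that offer survives the merge), or
-- both kept (merge the continuations inductively); in each case the result is again a
-- label-wise reduction of B.  All other constructors are congruences.
module Submission where

open import Defs
open import Data.Maybe using (Maybe; just; nothing)
open import Data.Product using (Σ; _×_; _,_)

module MergeOfReducts (P E V A X : Set) where
  open SP P E V A X

  data OptMoreBranches : Maybe (A × Behaviour) → Maybe (A × Behaviour) → Set where
    omb-nothing : ∀ {mB} → OptMoreBranches mB nothing
    omb-just    : ∀ {a B B'} → MoreBranches B B' →
                  OptMoreBranches (just (a , B)) (just (a , B'))

  more-branches-branch : ∀ {p ml mr ml' mr'} →
    OptMoreBranches ml ml' → OptMoreBranches mr mr' →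
    MoreBranches (Branch p ml mr) (Branch p ml' mr')
  more-branches-branch omb-nothing  omb-nothing  = mb-none
  more-branches-branch omb-nothing  (omb-just r) = mb-right r
  more-branches-branch (omb-just l) omb-nothing  = mb-left l
  more-branches-branch (omb-just l) (omb-just r) = mb-both l r

  data BranchReduct (p : P) (ml mr : Maybe (A × Behaviour)) : Behaviour → Set where
    branch-reduct : ∀ {ml' mr'} → OptMoreBranches ml ml' → OptMoreBranches mr mr' →
                    BranchReduct p ml mr (Branch p ml' mr')

  branch-reduct-of : ∀ {p ml mr B'} →
    MoreBranches (Branch p ml mr) B' → BranchReduct p ml mr B'
  branch-reduct-of mb-none       = branch-reduct omb-nothing omb-nothing
  branch-reduct-of (mb-right r)  = branch-reduct omb-nothing (omb-just r)
  branch-reduct-of (mb-left l)   = branch-reduct (omb-just l) omb-nothing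
  branch-reduct-of (mb-both l r) = branch-reduct (omb-just l) (omb-just r)

  more-branches-merge : ∀ B {B1 B2} → MoreBranches B B1 → MoreBranches B B2 →
    Σ Behaviour (λ B' → Merge B1 B2 B' × MoreBranches B B')

  opt-more-branches-merge : ∀ mB {mB1 mB2} →
    OptMoreBranches mB mB1 → OptMoreBranches mB mB2 →
    Σ (Maybe (A × Behaviour)) (λ mB' → MergeOpt mB1 mB2 mB' × OptMoreBranches mB mB')
  opt-more-branches-merge _ omb-nothing omb-nothing = nothing , mo-none , omb-nothing
  opt-more-branches-merge _ omb-nothing (omb-just k) = _ , mo-right , omb-just k
  opt-more-branches-merge _ (omb-just h) omb-nothing = _ , mo-left , omb-just h
  opt-more-branches-merge (just (a , B)) (omb-just h) (omb-just k)
    with more-branches-merge B h k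
  ... | B' , merge , more = just (a , B') , mo-both merge , omb-just more

  more-branches-merge End mb-end mb-end = End , m-end , mb-end
  more-branches-merge (Call x) mb-call mb-call = Call x , m-call , mb-call
  more-branches-merge (Send p e a B) (mb-send h) (mb-send k)
    with more-branches-merge B h k
  ... | B' , merge , more = Send p e a B' , m-send merge , mb-send more
  more-branches-merge (Recv p x a B) (mb-recv h) (mb-recv k)
    with more-branches-merge B h k
  ... | B' , merge , more = Recv p x a B' , m-recv merge , mb-recv more
  more-branches-merge (Sel p l a B) (mb-sel h) (mb-sel k)
    with more-branches-merge B h k
  ... | B' , merge , more = Sel p l a B' , m-sel merge , mb-sel more
  more-branches-merge (Ite e Bt Bf) (mb-ite ht hf) (mb-ite kt kf)
    with more-branches-merge Bt ht kt | more-branches-merge Bf hf kf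
  ... | Bt' , merget , moret | Bf' , mergef , moref =
    Ite e Bt' Bf' , m-ite merget mergef , mb-ite moret moref
  more-branches-merge (Branch p ml mr) h k
    with branch-reduct-of h | branch-reduct-of k
  ... | branch-reduct hl hr | branch-reduct kl kr
    with opt-more-branches-merge ml hl kl | opt-more-branches-merge mr hr kr
  ... | ml' , mergel , morel | mr' , merger , morer =
    Branch p ml' mr' , m-branch mergel merger , more-branches-branch morel morer

mainTheorem13 : (P E V A X : Set) → let open SP P E V A X in
    (B B1 B2 : Behaviour) → MoreBranches B B1 → MoreBranches B B2 →
    Σ Behaviour (λ B' → Merge B1 B2 B' × MoreBranches B B')
mainTheorem13 P E V A X B _ _ = MergeOfReducts.more-branches-merge P E V A X B
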